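{- The assignment $\Psi$, given on objects by $\Psi(\mathfrak K)=(\widetilde K,\preceq,{}^\perp)$ and on morphisms by $\Psi(\phi)=\phi|_{\widetilde K_1}$ for $\phi:\mathfrak K_1\to\mathfrak K_2$, is a functor from the category $\mathscr T\mathbb{ODA}$ of $\mathscr T$-based orthomodular dynamic algebras to the category $\mathbb{COL}$ of complete orthomodular lattices and ortholattice isomorphisms.
   Context: A unital involutive quantale $(K,\bigsqcup,\odot,{}^*,e)$: complete join-semilattice (binary join $\sqcup$), associative $\odot$ distributing over arbitrary joins on both sides, unit $e$, involution with $x^{**}=x$, $(x\odot y)^*=y^*\odot x^*$, $(\bigsqcup x_i)^*=\bigsqcup x_i^*$. An involutive generalized dynamic algebra (IDA) is $(K,\bigsqcup,\odot,{}^*,{\sim},e)$ with such a quantale and ${\sim}:K\to K$ satisfying for all $x,y$ and families $(x_i)$: ${\sim}(x\odot{\sim}{\sim}y)={\sim}(x\odot y)$; ${\sim}(\bigsqcup_i{\sim}{\sim}x_i)={\sim}(\bigsqcup_ix_i)$; $({\sim}x)^*={\sim}x$; ${\sim}{\sim}({\sim}{\sim}x\odot y)={\sim}({\sim}x\sqcup{\sim}({\sim}x\sqcup y))$. Notation: $\widetilde K=\{{\sim}k\}$; $\bigvee W={\sim}{\sim}\bigsqcup W$; $k\preceq l$ iff $\bigvee\{k,l\}=l$; $w^\perp={\sim}w$; $k\bullet v={\sim}{\sim}(k\odot v)$; $k\equiv l$ iff $k\bullet w=l\bullet w$ for all $w\in\widetilde K$. IDA morphisms preserve arbitrary joins, $\odot$,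 unit, ${}^*$, ${\sim}$. Semi-Foulis: $(\widetilde K,\preceq,{}^\perp)$ is a complete orthomodular lattice (OML). For a complete OML $\mathcal M$ with Sasaki projections $\pi_m(x)=m\wedge(m^\perp\vee x)$, $\mathbf{Lin}(\mathcal M)$ is the set of maps $f:M\to M$ admitting $f^*$ with $f(x)\le y^\perp\iff x\le f^*(y)^\perp$, with pointwise joins, $\odot=\circ$, involution $f^*$, unit $\mathrm{id}_M$, ${\sim}f=\pi_{f(1)^\perp}$ (an IDA). For an involutive submonoid $L\subseteq\mathbf{Lin}(\mathcal M)$ containing all $\pi_m$, $\mathscr P(L)$ is the IDA of subsets of $L$ with union, $A\odot B=\{a\circ b\}$, $A^*=\{a^*\}$, ${\sim}A=\{\pi_{(\bigvee_{a\in A}a(1))^\perp}\}$, unit $\{\mathrm{id}_M\}$. $\mathbb{IM}$: involutive monoids with maps preserving product, unit, involution. Fix a functor $\mathscr T$ from IDAs to $\mathbb{IM}$ with: (T1) $\widetilde K\subseteq\mathscr T(K)\subseteq K$, $\mathscr T(K)$ an involutive submonoid; (T2) for every semi-Foulis $\mathfrak K$ with $s=t\iff s\equiv t$ on $\mathscr T(K)$, $\nu_{\mathfrak K}(k)=k\bullet(-)$ is an $\mathbb{IM}$-isomorphism $\mathscr T(\mathfrak K)\to\mathscr T(\mathbf{Lin}(\widetilde K,\preceq,{}^\perp))$; (T3) for every complete OML $\mathcal M$, $f\mapsto\{f\}$ is an $\mathbb{IM}$-isomorphism $\mathscr T(\mathbf{Lin}(\mathcal M))\to\mathscr T(\mathscr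 P(\mathscr T(\mathbf{Lin}(\mathcal M))))$; (T4) $\mathscr T(f)$ is the restriction of $f$. A $\mathscr T$-based orthomodular dynamic algebra is an IDA with: (TODA1) $(\widetilde K,\preceq,{}^\perp)$ complete OML; (TODA2) any $A$ with $\mathscr T(K)\subseteq A\subseteq K$ closed under $\odot$, ${}^*$, arbitrary joins equals $K$; (TODA3) for $S,T\subseteq\mathscr T(K)$, $\bigsqcup S=\bigsqcup T$ iff $S=T$; (TODA4) for $s,t\in\mathscr T(K)$, $s=t$ iff $s\equiv t$. $\mathscr T\mathbb{ODA}$ has these as objects and bijective IDA morphisms as morphisms. $\mathbb{COL}$ has complete OMLs as objects and ortholattice isomorphisms (bijections $k$ with $m\le n\iff k(m)\le k(n)$ and $k(m^\perp)=k(m)^\perp$) as morphisms. -}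

module Defs where

open import Level using (Level; 0ℓ) renaming (suc to lsuc)
open import Data.Bool using (Bool; true; false)
open import Data.Product using (Σ; ∃; _×_; _,_; proj₁; proj₂)
open import Relation.Binary.Core using (Rel)
open import Relation.Binary.Structures using (IsEquivalence; IsPartialOrder)
open import Relation.Binary.PropositionalEquality
  using (_≡_; refl; sym; trans; cong; cong₂)
open import Function.Base using (_∘_; id)
open import Function.Definitions using (Bijective)
open import Function.Bundles using (_⇔_)

module _ {A : Set} (_≤_ : Rel A 0ℓ) where

  IsSup : {I : Set} → (I → A) → A → Set
  IsSup {I} f s = ((i : I) → f i ≤ s) × (∀ u → ((i : I) → f i ≤ u) → s ≤ u)

  IsJoin : A → A → A → Set
  IsJoin x y s = (x ≤ s) × (y ≤ s) × (∀ u → x ≤ u → y ≤ u → s ≤ u)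

  IsMeet : A → A → A → Set
  IsMeet x y m = (m ≤ x) × (m ≤ y) × (∀ u → u ≤ x → u ≤ y → u ≤ m)

  IsBottom : A → Set
  IsBottom z = ∀ y → z ≤ y

  IsTop : A → Set
  IsTop t = ∀ y → y ≤ t

record IsCompleteOML {A : Set} (_≈_ : Rel A 0ℓ) (_≤_ : Rel A 0ℓ) (_⊥ : A → A) : Set₁ where
  field
    isPartialOrder : IsPartialOrder _≈_ _≤_
    ⊥-cong         : ∀ {x y} → x ≈ y → (x ⊥) ≈ (y ⊥)
    complete       : {I : Set} (f : I → A) → ∃ λ s → IsSup _≤_ f s
    ⊥-involutive   : ∀ x → ((x ⊥) ⊥) ≈ x
    ⊥-antitone     : ∀ {x y} → x ≤ y → (y ⊥) ≤ (x ⊥)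
    meet-⊥         : ∀ x m → IsMeet _≤_ x (x ⊥) m → IsBottom _≤_ m
    join-⊥         : ∀ x j → IsJoin _≤_ x (x ⊥) j → IsTop _≤_ j
    orthomodular   : ∀ {x y} → x ≤ y → ∀ m j →
                     IsMeet _≤_ (x ⊥) y m → IsJoin _≤_ x m j → j ≈ y

record CompleteOML : Set₁ where
  field
    Carrier       : Set
    _≈_           : Rel Carrier 0ℓ
    _≤_           : Rel Carrier 0ℓ
    _⊥            : Carrier → Carrier
    isCompleteOML : IsCompleteOML _≈_ _≤_ _⊥

record IsOrthoIso (M N : CompleteOML) (k : CompleteOML.Carrier M → CompleteOML.Carrier N) : Set where
  private
    module M = CompleteOML M
    module N = CompleteOML N
  field
    respects-≈ : ∀ {m n} → m M.≈ n → k m N.≈ k n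
    injective  : ∀ {m n} → k m N.≈ k n → m M.≈ n
    surjective : ∀ y → ∃ λ x → k x N.≈ y
    order      : ∀ m n → (m M.≤ n) ⇔ (k m N.≤ k n)
    ortho      : ∀ m → k (m M.⊥) N.≈ ((k m) N.⊥)

-- Involutive generalized dynamic algebras

pair : {A : Set} → A → A → Bool → A
pair x y true  = x
pair x y false = y

record IDA : Set₁ where
  infixl 7 _⊙_
  field
    Carrier : Set
    _≤_     : Rel Carrier 0ℓ
    ⨆       : {I : Set} → (I → Carrier) → Carrier
    _⊙_     : Carrier → Carrier → Carrier
    _*      : Carrier → Carrier
    ~       : Carrier → Carrier
    e       : Carrier
    ≤-isPartialOrder : IsPartialOrder _≡_ _≤_
    ⨆-isSup   : {I : Set} (f : I → Carrier) → IsSup _≤_ f (⨆ f)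
    ⊙-assoc   : ∀ x y z → (x ⊙ y) ⊙ z ≡ x ⊙ (y ⊙ z)
    ⊙-identityˡ : ∀ x → e ⊙ x ≡ x
    ⊙-identityʳ : ∀ x → x ⊙ e ≡ x
    ⊙-distribˡ-⨆ : ∀ x {I : Set} (f : I → Carrier) → x ⊙ ⨆ f ≡ ⨆ (λ i → x ⊙ f i)
    ⊙-distribʳ-⨆ : ∀ x {I : Set} (f : I → Carrier) → ⨆ f ⊙ x ≡ ⨆ (λ i → f i ⊙ x)
    *-involutive : ∀ x → (x *) * ≡ x
    *-⊙          : ∀ x y → (x ⊙ y) * ≡ (y *) ⊙ (x *)
    *-⨆          : {I : Set} (f : I → Carrier) → (⨆ f) * ≡ ⨆ (λ i → f i *)
    ~-⊙   : ∀ x y → ~ (x ⊙ ~ (~ y)) ≡ ~ (x ⊙ y)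
    ~-⨆   : {I : Set} (f : I → Carrier) → ~ (⨆ (λ i → ~ (~ (f i)))) ≡ ~ (⨆ f)
    ~-*   : ∀ x → (~ x) * ≡ ~ x
    ~-ax4 : ∀ x y → ~ (~ (~ (~ x) ⊙ y)) ≡ ~ (⨆ (pair (~ x) (~ (⨆ (pair (~ x) y)))))

  _⊔_ : Carrier → Carrier → Carrier
  x ⊔ y = ⨆ (pair x y)

  ⨆ₛ : (Carrier → Set) → Carrier
  ⨆ₛ W = ⨆ {Σ Carrier W} proj₁

  InTilde : Carrier → Set
  InTilde k = ∃ λ x → k ≡ ~ x

  Tilde : Set
  Tilde = Σ Carrier InTilde

  ⋁ : (Carrier → Set) → Carrier
  ⋁ W = ~ (~ (⨆ₛ W))

  _⪯_ : Carrier → Carrier → Set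
  k ⪯ l = ~ (~ (k ⊔ l)) ≡ l

  _⊥ : Carrier → Carrier
  w ⊥ = ~ w

  _•_ : Carrier → Carrier → Carrier
  k • v = ~ (~ (k ⊙ v))

  _≡K_ : Carrier → Carrier → Set
  k ≡K l = ∀ w → InTilde w → k • w ≡ l • w

  _≈̃_ : Rel Tilde 0ℓ
  a ≈̃ b = proj₁ a ≡ proj₁ b

  _⪯̃_ : Rel Tilde 0ℓ
  a ⪯̃ b = proj₁ a ⪯ proj₁ b

  _⊥̃ : Tilde → Tilde
  a ⊥̃ = (~ (proj₁ a)) , (proj₁ a , refl)

record IsIDAHom (K L : IDA) (f : IDA.Carrier K → IDA.Carrier L) : Set₁ where
  private
    module K = IDA K
    module L = IDA L
  field
    pres-⨆ : {I : Set} (g : I → K.Carrier) → f (K.⨆ g) ≡ L.⨆ (f ∘ g)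
    pres-⊙ : ∀ x y → f (x K.⊙ y) ≡ f x L.⊙ f y
    pres-e : f K.e ≡ L.e
    pres-* : ∀ x → f (x K.*) ≡ (f x) L.*
    pres-~ : ∀ x → f (K.~ x) ≡ L.~ (f x)

-- The functor 𝒯 (only the properties T1 and T4 are recorded)

record TFunctor : Set₂ where
  field
    𝒯 : (K : IDA) → IDA.Carrier K → Set
    tilde⊆𝒯 : (K : IDA) → ∀ k → IDA.InTilde K k → 𝒯 K k
    𝒯-⊙     : (K : IDA) → ∀ x y → 𝒯 K x → 𝒯 K y → 𝒯 K (IDA._⊙_ K x y)
    𝒯-*     : (K : IDA) → ∀ x → 𝒯 K x → 𝒯 K (IDA._* K x)
    𝒯-e     : (K : IDA) → 𝒯 K (IDA.e K)
    -- (T4)  𝒯(f) is the restriction of f (in particular it is well defined)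
    𝒯-map   : (K L : IDA) (f : IDA.Carrier K → IDA.Carrier L) → IsIDAHom K L f →
              ∀ x → 𝒯 K x → 𝒯 L (f x)

-- 𝒯-based orthomodular dynamic algebras

module _ (𝕋 : TFunctor) where
  open TFunctor 𝕋

  record TODA : Set₁ where
    field
      ida : IDA
    open IDA ida
    field
      toda1 : IsCompleteOML _≈̃_ _⪯̃_ _⊥̃
      toda2 : (A : Carrier → Set) →
              (∀ k → 𝒯 ida k → A k) →
              (∀ x y → A x → A y → A (x ⊙ y)) →
              (∀ x → A x → A (x *)) →
              ({I : Set} (f : I → Carrier) → (∀ i → A (f i)) → A (⨆ f)) →
              ∀ k → A k
      toda3 : (S T : Carrier → Set) →
              (∀ k → S k → 𝒯 ida k) → (∀ k → T k → 𝒯 ida k) →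
              (⨆ₛ S ≡ ⨆ₛ T) ⇔ (∀ k → (S k ⇔ T k))
      toda4 : ∀ s t → 𝒯 ida s → 𝒯 ida t → (s ≡ t) ⇔ (s ≡K t)

  record TODAMor (K L : TODA) : Set₁ where
    field
      fun    : IDA.Carrier (TODA.ida K) → IDA.Carrier (TODA.ida L)
      isHom  : IsIDAHom (TODA.ida K) (TODA.ida L) fun
      bij    : Bijective _≡_ _≡_ fun

  idHom : (K : IDA) → IsIDAHom K K id
  idHom K = record
    { pres-⨆ = λ g → refl ; pres-⊙ = λ x y → refl ; pres-e = refl
    ; pres-* = λ x → refl ; pres-~ = λ x → refl }

  idMor : (K : TODA) → TODAMor K K
  idMor K = record
    { fun = id ; isHom = idHom (TODA.ida K)
    ; bij = (λ p → p) , (λ y → y , λ p → p) }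

  compHom : (K L M : IDA) (f : IDA.Carrier K → IDA.Carrier L) (g : IDA.Carrier L → IDA.Carrier M) →
            IsIDAHom K L f → IsIDAHom L M g → IsIDAHom K M (g ∘ f)
  compHom K L M f g hf hg = record
    { pres-⨆ = λ h → trans (cong g (F.pres-⨆ h)) (G.pres-⨆ (f ∘ h))
    ; pres-⊙ = λ x y → trans (cong g (F.pres-⊙ x y)) (G.pres-⊙ (f x) (f y))
    ; pres-e = trans (cong g F.pres-e) G.pres-e
    ; pres-* = λ x → trans (cong g (F.pres-* x)) (G.pres-* (f x))
    ; pres-~ = λ x → trans (cong g (F.pres-~ x)) (G.pres-~ (f x)) }
    where
      module F = IsIDAHom hf
      module G = IsIDAHom hg

  _∘M_ : {K L M : TODA} → TODAMor L M → TODAMor K L → TODAMor K M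
  _∘M_ {K} {L} {M} ψ φ = record
    { fun = Ψf ∘ Φf
    ; isHom = compHom (TODA.ida K) (TODA.ida L) (TODA.ida M) Φf Ψf
                      (TODAMor.isHom φ) (TODAMor.isHom ψ)
    ; bij = (λ p → proj₁ (TODAMor.bij φ) (proj₁ (TODAMor.bij ψ) p))
          , λ z → let (y , hy) = proj₂ (TODAMor.bij ψ) z
                      (x , hx) = proj₂ (TODAMor.bij φ) y
                  in x , λ p → hy (hx p) }
    where
      Φf = TODAMor.fun φ
      Ψf = TODAMor.fun ψ

  Ψobj : TODA → CompleteOML
  Ψobj K = record
    { Carrier = IDA.Tilde (TODA.ida K)
    ; _≈_ = IDA._≈̃_ (TODA.ida K)
    ; _≤_ = IDA._⪯̃_ (TODA.ida K)
    ; _⊥ = IDA._⊥̃ (TODA.ida K)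
    ; isCompleteOML = TODA.toda1 K }

  -- Ψ(φ) = φ restricted to K̃₁ (it lands in K̃₂ since φ preserves ~)
  Ψmor : {K L : TODA} → TODAMor K L → CompleteOML.Carrier (Ψobj K) → CompleteOML.Carrier (Ψobj L)
  Ψmor φ (k , x , p) = TODAMor.fun φ k , TODAMor.fun φ x ,
                       trans (cong (TODAMor.fun φ) p) (IsIDAHom.pres-~ (TODAMor.isHom φ) x)

-- The order ⪯ and the orthocomplement on K̃ are defined by IDA terms in ~ and ⊔,
-- so a bijective IDA morphism, which preserves ~ and joins, restricts to an
-- order-embedding of K̃₁ onto K̃₂ commuting with ⊥.  Functoriality holds on the
-- nose, since Ψ acts by restriction.
module Submission where

open import Defs
open import Data.Bool using (true; false)
open import Data.Product using (∃; _×_; _,_; proj₁; proj₂)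
open import Function.Bundles using (mk⇔)
open import Function.Definitions using (Injective; Surjective)
open import Relation.Binary.PropositionalEquality
open import Relation.Binary.Structures using (IsPartialOrder)

module _ (K : IDA) where
  open IDA K

  ⨆-cong : {I : Set} {g h : I → Carrier} → (∀ i → g i ≡ h i) → ⨆ g ≡ ⨆ h
  ⨆-cong {g = g} {h} g≗h = IsPartialOrder.antisym ≤-isPartialOrder
    (⨆-mono g h (λ i → g≗h i)) (⨆-mono h g (λ i → sym (g≗h i)))
    where
      ⨆-mono : ∀ {I} (u v : I → Carrier) → (∀ i → u i ≡ v i) → ⨆ u ≤ ⨆ v
      ⨆-mono u v u≗v = proj₂ (⨆-isSup u) (⨆ v)
        (λ i → subst (_≤ ⨆ v) (sym (u≗v i)) (proj₁ (⨆-isSup v) i))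

module _ {K L : IDA} {f : IDA.Carrier K → IDA.Carrier L} (hom : IsIDAHom K L f) where
  private
    module K = IDA K
    module L = IDA L
  open IsIDAHom hom

  pres-⊔ : ∀ x y → f (x K.⊔ y) ≡ f x L.⊔ f y
  pres-⊔ x y = trans (pres-⨆ (pair x y)) (⨆-cong L λ { true → refl ; false → refl })

  pres-~~⊔ : ∀ m n → f (K.~ (K.~ (m K.⊔ n))) ≡ L.~ (L.~ (f m L.⊔ f n))
  pres-~~⊔ m n = begin
    f (K.~ (K.~ (m K.⊔ n)))     ≡⟨ pres-~ _ ⟩
    L.~ (f (K.~ (m K.⊔ n)))     ≡⟨ cong L.~ (pres-~ _) ⟩
    L.~ (L.~ (f (m K.⊔ n)))     ≡⟨ cong (λ z → L.~ (L.~ z)) (pres-⊔ m n) ⟩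
    L.~ (L.~ (f m L.⊔ f n))     ∎
    where open ≡-Reasoning

  pres-⪯ : ∀ {m n} → m K.⪯ n → f m L.⪯ f n
  pres-⪯ {m} {n} m⪯n = trans (sym (pres-~~⊔ m n)) (cong f m⪯n)

  reflects-⪯ : Injective _≡_ _≡_ f → ∀ {m n} → f m L.⪯ f n → m K.⪯ n
  reflects-⪯ inj {m} {n} fm⪯fn = inj (trans (pres-~~⊔ m n) fm⪯fn)

  surjective-onto-Tilde : Surjective _≡_ _≡_ f →
                          ∀ y → L.InTilde y → ∃ λ x → K.InTilde x × f x ≡ y
  surjective-onto-Tilde surj y (z , y≡~z) =
    let (x , fx≡z) = preimage z in
    K.~ x , (x , refl) , trans (pres-~ x) (trans (cong L.~ fx≡z) (sym y≡~z))
    where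
      preimage : ∀ y → ∃ λ x → f x ≡ y
      preimage y = proj₁ (surj y) , proj₂ (surj y) refl

module _ (𝕋 : TFunctor) {K L : TODA 𝕋} (φ : TODAMor 𝕋 K L) where
  open TODAMor φ

  Ψmor-isOrthoIso : IsOrthoIso (Ψobj 𝕋 K) (Ψobj 𝕋 L) (Ψmor 𝕋 {K} {L} φ)
  Ψmor-isOrthoIso = record
    { respects-≈ = cong fun
    ; injective  = proj₁ bij
    ; surjective = λ (y , y∈K̃) →
        let (x , x∈K̃ , fx≡y) = surjective-onto-Tilde isHom (proj₂ bij) y y∈K̃
        in (x , x∈K̃) , fx≡y
    ; order      = λ (m , _) (n , _) → mk⇔ (pres-⪯ isHom) (reflects-⪯ isHom (proj₁ bij))
    ; ortho      = λ (m , _) → IsIDAHom.pres-~ isHom m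
    }

theorem6p1 : (𝕋 : TFunctor) →
    ((K L : TODA 𝕋) (φ : TODAMor 𝕋 K L) →
      IsOrthoIso (Ψobj 𝕋 K) (Ψobj 𝕋 L) (Ψmor 𝕋 {K} {L} φ))
    × ((K : TODA 𝕋) (w : CompleteOML.Carrier (Ψobj 𝕋 K)) →
      CompleteOML._≈_ (Ψobj 𝕋 K) (Ψmor 𝕋 {K} {K} (idMor 𝕋 K) w) w)
    × ((K L M : TODA 𝕋) (φ : TODAMor 𝕋 K L) (ψ : TODAMor 𝕋 L M)
       (w : CompleteOML.Carrier (Ψobj 𝕋 K)) →
      CompleteOML._≈_ (Ψobj 𝕋 M)
        (Ψmor 𝕋 {K} {M} (_∘M_ 𝕋 {K} {L} {M} ψ φ) w)
        (Ψmor 𝕋 {L} {M} ψ (Ψmor 𝕋 {K} {L} φ w)))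
theorem6p1 𝕋 =
    (λ K L φ → Ψmor-isOrthoIso 𝕋 φ)
  , (λ K w → refl)
  , (λ K L M φ ψ w → refl)
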